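{- Let $m<n$ be positive integers, and let $P_m$ and $P_n$ be orientations of paths on $m$ and $n$ vertices, respectively, such that $P_m$ is a subdigraph of $P_n$. Then $\chi_d(P_m)\le \chi_d(P_n)$.
   Context: For a digraph $D$ and $v\in V(D)$, $N^+(v)=\{u: vu\in A(D)\}$. A dominator coloring of $D$ is a partition of $V(D)$ into color classes such that (i) it is a proper coloring of the underlying graph (adjacent vertices receive different colors), and (ii) every vertex $v$ with at least one out-neighbor dominates some color class, i.e., there is a color class $C$ with $C\subseteq N^+(v)$; vertices of out-degree $0$ are not required to dominate anything. $\chi_d(D)$ is the minimum number of color classes in a dominator coloring of the given digraph $D$. -}

module Defs where

open import Data.Nat using (ℕ; suc; _∸_; _≤_)
open import Data.Fin using (Fin; toℕ)
open import Data.Bool using (Bool; true; false)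
open import Data.Product using (Σ; _×_; ∃)
open import Data.Sum using (_⊎_)
open import Data.Empty using (⊥)
open import Relation.Nullary using (¬_)
open import Relation.Binary.PropositionalEquality using (_≡_)
open import Function.Definitions using (Injective)
open import Level using (0ℓ)

record Digraph : Set₁ where
  field
    order : ℕ
    Arc   : Fin order → Fin order → Set

open Digraph public

Adj : (D : Digraph) → Fin (order D) → Fin (order D) → Set
Adj D u v = Arc D u v ⊎ Arc D v u

HasOut : (D : Digraph) → Fin (order D) → Set
HasOut D v = ∃ λ u → Arc D v u

-- A dominator coloring of D using (at most) k colors:
-- c is a proper coloring of the underlying graph, and every vertex with an
-- out-neighbour dominates some (nonempty) color class C, i.e. C ⊆ N⁺(v).
IsDominatorColoring : (D : Digraph) (k : ℕ) → (Fin (order D) → Fin k) → Set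
IsDominatorColoring D k c =
  (∀ u v → Adj D u v → ¬ (c u ≡ c v)) ×
  (∀ v → HasOut D v →
     Σ (Fin k) λ j → (∃ λ w → c w ≡ j) × (∀ w → c w ≡ j → Arc D v w))

HasDominatorColoring : Digraph → ℕ → Set
HasDominatorColoring D k = Σ (Fin (order D) → Fin k) (IsDominatorColoring D k)

IsDomChromaticNumber : Digraph → ℕ → Set
IsDomChromaticNumber D k =
  HasDominatorColoring D k × (∀ j → HasDominatorColoring D j → k ≤ j)

-- An orientation of the path v₀ v₁ … v_{n-1} on n vertices: for each edge
-- {vᵢ, vᵢ₊₁} (i < n-1), o i = true means the arc vᵢ → vᵢ₊₁, false means vᵢ₊₁ → vᵢ.
PathOrientation : ℕ → Set
PathOrientation n = Fin (n ∸ 1) → Bool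

OrientedPath : (n : ℕ) → PathOrientation n → Digraph
OrientedPath n o = record
  { order = n
  ; Arc = λ u v → Σ (Fin (n ∸ 1)) λ i →
        (o i ≡ true  × toℕ u ≡ toℕ i × toℕ v ≡ suc (toℕ i))
      ⊎ (o i ≡ false × toℕ v ≡ toℕ i × toℕ u ≡ suc (toℕ i))
  }

IsSubdigraph : Digraph → Digraph → Set
IsSubdigraph D H = Σ (Fin (order D) → Fin (order H)) λ f →
  Injective _≡_ _≡_ f × (∀ u v → Arc D u v → Arc H (f u) (f v))

-- An arc-preserving injection of one oriented path into another moves along the longer path
-- by one vertex per step and never turns back, so it is a translation or a reflection of the
-- vertex indices: P_m is a subpath of P_n, read forwards or backwards.  It therefore suffices
-- that deleting an end vertex of an oriented path keeps a dominator coloring with the same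
-- number of colors; by reversal, only the first vertex needs an argument, and there a color
-- left unused by the deletion is recycled.
module Submission where

open import Defs
open import Data.Nat
  using (ℕ; zero; suc; _+_; _∸_; _≤_; _<_; _≤′_; ≤′-reflexive; ≤′-step; z≤n; s≤s; s≤s⁻¹; _<?_)
open import Data.Nat.Properties
  using ( suc-injective; 1+n≢n; +-suc; +-comm; +-assoc; +-identityʳ; +-cancelˡ-≡; +-cancelʳ-≡
        ; m+n∸n≡m; m+n∸m≡n; m∸n+n≡m; ∸-monoˡ-≤; ≤-trans; <⇒≤; n<1+n; m≤n+m; ≤⇒≤′ )
open import Data.Fin using (Fin; toℕ; fromℕ<; opposite) renaming (zero to fzero; suc to fsuc)
open import Data.Fin.Properties
  using ( toℕ<n; toℕ-fromℕ<; fromℕ<-toℕ; toℕ-injective; opposite-prop; opposite-involutive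
        ; any?; _≟_ )
open import Data.Vec.Functional using (updateAt)
open import Data.Vec.Functional.Properties using (updateAt-updates; updateAt-minimal)
open import Data.Bool using (Bool; true; false; not)
open import Data.Bool.Properties using (not-involutive)
open import Data.Product using (Σ; _×_; ∃; _,_)
open import Data.Sum using (_⊎_; inj₁; inj₂; swap)
open import Data.Empty using (⊥-elim)
open import Function using (_∘_; const)
open import Function.Definitions using (Injective)
open import Relation.Nullary using (¬_; yes; no)
open import Relation.Binary.PropositionalEquality
  using (_≡_; _≢_; refl; sym; trans; cong; subst; subst₂; module ≡-Reasoning)
open ≡-Reasoning

IsProperColoring : (D : Digraph) (k : ℕ) → (Fin (order D) → Fin k) → Set
IsProperColoring D k c = ∀ u v → Adj D u v → c u ≢ c v

DominatesAClass : (D : Digraph) (k : ℕ) → (Fin (order D) → Fin k) → Fin (order D) → Set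
DominatesAClass D k c v = Σ (Fin k) λ j → (∃ λ w → c w ≡ j) × (∀ w → c w ≡ j → Arc D v w)

2+n≢n : ∀ {n} → suc (suc n) ≢ n
2+n≢n {suc n} = 2+n≢n ∘ suc-injective

IsProperColoring-update :
  ∀ {D k} {c : Fin (order D) → Fin k} x j → IsProperColoring D k c →
  (∀ y → Adj D x y → c y ≢ j) →
  IsProperColoring D k (updateAt c x (const j))
IsProperColoring-update {c = c} x j proper fresh u v adj
  with u ≟ x | v ≟ x
... | yes refl | yes refl = λ _ → proper u u adj refl
... | yes refl | no v≢x   = λ eq →
  fresh v adj (trans (sym (updateAt-minimal v x c v≢x)) (trans (sym eq) (updateAt-updates x c)))
... | no u≢x   | yes refl = λ eq →
  fresh u (swap adj) (trans (sym (updateAt-minimal u x c u≢x)) (trans eq (updateAt-updates x c)))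
... | no u≢x   | no v≢x   = λ eq →
  proper u v adj (trans (sym (updateAt-minimal u x c u≢x)) (trans eq (updateAt-minimal v x c v≢x)))

IsProperColoring-restrict :
  ∀ {D H k} (e : Fin (order H) → Fin (order D)) →
  (∀ u v → Arc H u v → Arc D (e u) (e v)) →
  ∀ {c} → IsProperColoring D k c → IsProperColoring H k (c ∘ e)
IsProperColoring-restrict e preserves proper u v (inj₁ a) =
  proper (e u) (e v) (inj₁ (preserves u v a))
IsProperColoring-restrict e preserves proper u v (inj₂ a) =
  proper (e u) (e v) (inj₂ (preserves v u a))

IsDominatorColoring-restrict :
  ∀ {D H k} (e : Fin (order H) → Fin (order D)) →
  (∀ u v → Arc H u v → Arc D (e u) (e v)) →
  (∀ u v → Arc D (e u) (e v) → Arc H u v) →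
  ∀ {c} → IsDominatorColoring D k c →
  (∀ w → ∃ λ w′ → c (e w′) ≡ c w) →
  IsDominatorColoring H k (c ∘ e)
IsDominatorColoring-restrict {D} {H} {k} e preserves reflects {c} (proper , dominating) meets =
  IsProperColoring-restrict {D} {H} e preserves proper
  , λ { v (u , a) → dominated v (dominating (e v) (e u , preserves v u a)) }
  where
  dominated : ∀ v → DominatesAClass D k c (e v) → DominatesAClass H k (c ∘ e) v
  dominated v (j , (w , cw≡j) , ⊆N⁺) =
    let w′ , cw′≡cw = meets w in
    j , (w′ , trans cw′≡cw cw≡j) , λ w″ cw″≡j → reflects v w″ (⊆N⁺ (e w″) cw″≡j)

HasDominatorColoring-transport :
  ∀ {D H k} (e : Fin (order H) → Fin (order D)) (s : Fin (order D) → Fin (order H)) →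
  (∀ w → e (s w) ≡ w) →
  (∀ u v → Arc H u v → Arc D (e u) (e v)) →
  (∀ u v → Arc D (e u) (e v) → Arc H u v) →
  HasDominatorColoring D k → HasDominatorColoring H k
HasDominatorColoring-transport {D} e s e∘s≗id preserves reflects (c , isDC) =
  c ∘ e , IsDominatorColoring-restrict {D} e preserves reflects isDC (λ w → s w , cong c (e∘s≗id w))

IsDominatorColoring-arcless :
  ∀ {D k c} → (∀ u v → ¬ Arc D u v) → IsDominatorColoring D k c
IsDominatorColoring-arcless noArc =
  (λ { u v (inj₁ a) → ⊥-elim (noArc u v a) ; u v (inj₂ a) → ⊥-elim (noArc v u a) })
  , λ { v (u , a) → ⊥-elim (noArc v u a) }

-- OrientedPath with its orientation indexed by all of ℕ (values beyond the last edge are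
-- irrelevant), so that shifting and cutting paths needs no arithmetic on Fin.
Step : (ℕ → Bool) → ℕ → ℕ → Set
Step O x y = (O x ≡ true × y ≡ suc x) ⊎ (O y ≡ false × x ≡ suc y)

Path : ℕ → (ℕ → Bool) → Digraph
Path n O = record { order = n ; Arc = λ u v → Step O (toℕ u) (toℕ v) }

Step-irrefl : ∀ O x → ¬ Step O x x
Step-irrefl O x (inj₁ (_ , x≡1+x)) = 1+n≢n (sym x≡1+x)
Step-irrefl O x (inj₂ (_ , x≡1+x)) = 1+n≢n (sym x≡1+x)

Step-adjacent : ∀ {O x y} → Step O x y → y ≡ suc x ⊎ x ≡ suc y
Step-adjacent (inj₁ (_ , y≡1+x)) = inj₁ y≡1+x
Step-adjacent (inj₂ (_ , x≡1+y)) = inj₂ x≡1+y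

Step-edge : ∀ O x → Step O x (suc x) ⊎ Step O (suc x) x
Step-edge O x with O x
... | true  = inj₁ (inj₁ (refl , refl))
... | false = inj₂ (inj₂ (refl , refl))

Step-suc : ∀ {O x y} → Step (O ∘ suc) x y → Step O (suc x) (suc y)
Step-suc (inj₁ (o , y≡1+x)) = inj₁ (o , cong suc y≡1+x)
Step-suc (inj₂ (o , x≡1+y)) = inj₂ (o , cong suc x≡1+y)

Step-pred : ∀ {O x y} → Step O (suc x) (suc y) → Step (O ∘ suc) x y
Step-pred (inj₁ (o , eq)) = inj₁ (o , suc-injective eq)
Step-pred (inj₂ (o , eq)) = inj₂ (o , suc-injective eq)

Step-forward⇒true : ∀ {O x} → Step O x (suc x) → O x ≡ true
Step-forward⇒true (inj₁ (o , _)) = o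
Step-forward⇒true (inj₂ (_ , x≡2+x)) = ⊥-elim (2+n≢n (sym x≡2+x))

Step-backward⇒false : ∀ {O x} → Step O (suc x) x → O x ≡ false
Step-backward⇒false (inj₁ (_ , x≡2+x)) = ⊥-elim (2+n≢n (sym x≡2+x))
Step-backward⇒false (inj₂ (o , _)) = o

orientation-≡ :
  ∀ {O O′ x y} →
  (Step O x (suc x) → Step O′ y (suc y)) × (Step O (suc x) x → Step O′ (suc y) y) →
  O x ≡ O′ y
orientation-≡ {O} {O′} {x} {y} (forward , backward) with Step-edge O x
... | inj₁ s = trans (Step-forward⇒true {O} s) (sym (Step-forward⇒true {O′} {y} (forward s)))
... | inj₂ s = trans (Step-backward⇒false {O} s) (sym (Step-backward⇒false {O′} {y} (backward s)))

orientation-≡-not :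
  ∀ {O O′ x y} →
  (Step O x (suc x) → Step O′ (suc y) y) × (Step O (suc x) x → Step O′ y (suc y)) →
  O x ≡ not (O′ y)
orientation-≡-not {O} {O′} {x} {y} (forward , backward) with Step-edge O x
... | inj₁ s =
  trans (Step-forward⇒true {O} s) (sym (cong not (Step-backward⇒false {O′} {y} (forward s))))
... | inj₂ s =
  trans (Step-backward⇒false {O} s) (sym (cong not (Step-forward⇒true {O′} {y} (backward s))))

extend : ∀ {A : Set} n → A → (Fin n → A) → ℕ → A
extend n default f a with a <? n
... | yes a<n = f (fromℕ< a<n)
... | no  _   = default

extend-< : ∀ {A : Set} {n default} {f : Fin n → A} {a} (a<n : a < n) →
           extend n default f a ≡ f (fromℕ< a<n)
extend-< {n = n} {a = a} a<n with a <? n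
... | yes _   = refl
... | no  a≮n = ⊥-elim (a≮n a<n)

extend-toℕ : ∀ {A : Set} {n default} {f : Fin n → A} (i : Fin n) → extend n default f (toℕ i) ≡ f i
extend-toℕ {f = f} i = trans (extend-< (toℕ<n i)) (cong f (fromℕ<-toℕ i (toℕ<n i)))

orientationℕ : ∀ n → PathOrientation n → ℕ → Bool
orientationℕ n o = extend (n ∸ 1) false o

edge-index< : ∀ {n x} → suc x < n → x < n ∸ 1
edge-index< = ∸-monoˡ-≤ 1

OrientedPath-arc⇒Step :
  ∀ {n o} (u v : Fin n) → Arc (OrientedPath n o) u v → Step (orientationℕ n o) (toℕ u) (toℕ v)
OrientedPath-arc⇒Step {n} {o} u v (i , inj₁ (oi , u≡i , v≡1+i)) =
  inj₁ ( trans (cong (orientationℕ n o) u≡i) (trans (extend-toℕ i) oi)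
       , trans v≡1+i (cong suc (sym u≡i)) )
OrientedPath-arc⇒Step {n} {o} u v (i , inj₂ (oi , v≡i , u≡1+i)) =
  inj₂ ( trans (cong (orientationℕ n o) v≡i) (trans (extend-toℕ i) oi)
       , trans u≡1+i (cong suc (sym v≡i)) )

Step⇒OrientedPath-arc :
  ∀ {n o} (u v : Fin n) → Step (orientationℕ n o) (toℕ u) (toℕ v) → Arc (OrientedPath n o) u v
Step⇒OrientedPath-arc {n} {o} u v (inj₁ (ou , v≡1+u)) =
  fromℕ< i< ,
  inj₁ (trans (sym (extend-< i<)) ou , sym (toℕ-fromℕ< i<) , trans v≡1+u (cong suc (sym (toℕ-fromℕ< i<))))
  where
  i< : toℕ u < n ∸ 1
  i< = edge-index< (subst (_< n) v≡1+u (toℕ<n v))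
Step⇒OrientedPath-arc {n} {o} u v (inj₂ (ov , u≡1+v)) =
  fromℕ< i< ,
  inj₂ (trans (sym (extend-< i<)) ov , sym (toℕ-fromℕ< i<) , trans u≡1+v (cong suc (sym (toℕ-fromℕ< i<))))
  where
  i< : toℕ v < n ∸ 1
  i< = edge-index< (subst (_< n) u≡1+v (toℕ<n u))

OrientedPath⇒Path : ∀ {n o k} →
  HasDominatorColoring (OrientedPath n o) k → HasDominatorColoring (Path n (orientationℕ n o)) k
OrientedPath⇒Path {n} {o} =
  HasDominatorColoring-transport {OrientedPath n o} {Path n (orientationℕ n o)}
    (λ u → u) (λ u → u) (λ _ → refl) (Step⇒OrientedPath-arc {n} {o}) (OrientedPath-arc⇒Step {n} {o})

Path⇒OrientedPath : ∀ {n o k} →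
  HasDominatorColoring (Path n (orientationℕ n o)) k → HasDominatorColoring (OrientedPath n o) k
Path⇒OrientedPath {n} {o} =
  HasDominatorColoring-transport {Path n (orientationℕ n o)} {OrientedPath n o}
    (λ u → u) (λ u → u) (λ _ → refl) (OrientedPath-arc⇒Step {n} {o}) (Step⇒OrientedPath-arc {n} {o})

Step-cong : ∀ {n O O′} → (∀ a → suc a < n → O a ≡ O′ a) →
            (u v : Fin n) → Step O (toℕ u) (toℕ v) → Step O′ (toℕ u) (toℕ v)
Step-cong {n} O≗O′ u v (inj₁ (ou , v≡1+u)) =
  inj₁ (trans (sym (O≗O′ (toℕ u) (subst (_< n) v≡1+u (toℕ<n v)))) ou , v≡1+u)
Step-cong {n} O≗O′ u v (inj₂ (ov , u≡1+v)) =
  inj₂ (trans (sym (O≗O′ (toℕ v) (subst (_< n) u≡1+v (toℕ<n u)))) ov , u≡1+v)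

Path-cong : ∀ {n O O′ k} → (∀ a → suc a < n → O a ≡ O′ a) →
            HasDominatorColoring (Path n O) k → HasDominatorColoring (Path n O′) k
Path-cong {n} {O} {O′} O≗O′ =
  HasDominatorColoring-transport {Path n O} {Path n O′} (λ u → u) (λ u → u) (λ _ → refl)
    (Step-cong (λ a a< → sym (O≗O′ a a<))) (Step-cong O≗O′)

-- Edge a of a path with N edges, read backwards, is edge b = N - 1 - a with its direction flipped.
IsReversal : ℕ → (ℕ → Bool) → (ℕ → Bool) → Set
IsReversal N O O′ = ∀ a b → b + suc a ≡ N → O′ a ≡ not (O b)

IsReversal-sym : ∀ {N O O′} → IsReversal N O O′ → IsReversal N O′ O
IsReversal-sym {N} {O} {O′} rev a b b+1+a≡N =
  trans (sym (not-involutive (O a))) (cong not (sym (rev b a a+1+b≡N)))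
  where
  a+1+b≡N : a + suc b ≡ N
  a+1+b≡N = trans (+-suc a b) (trans (cong suc (+-comm a b)) (trans (sym (+-suc b a)) b+1+a≡N))

mirror-suc : ∀ {X x Y y N} → X + x ≡ N → Y + y ≡ N → Y ≡ suc X → x ≡ suc y
mirror-suc {X} {x} {Y} {y} {N} X+x≡N Y+y≡N Y≡1+X = +-cancelˡ-≡ X x (suc y) (begin
  X + x       ≡⟨ X+x≡N ⟩
  N           ≡⟨ sym Y+y≡N ⟩
  Y + y       ≡⟨ cong (_+ y) Y≡1+X ⟩
  suc X + y   ≡⟨ sym (+-suc X y) ⟩
  X + suc y   ∎)

Step-reverse : ∀ {N O O′ x y x̄ ȳ} → IsReversal N O O′ → x̄ + x ≡ N → ȳ + y ≡ N →
               Step O x̄ ȳ → Step O′ x y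
Step-reverse {N} {x = x} {y} {x̄} {ȳ} rev x̄+x≡N ȳ+y≡N (inj₁ (ox̄ , ȳ≡1+x̄)) =
  inj₂ (trans (rev y x̄ (subst (λ z → x̄ + z ≡ N) x≡1+y x̄+x≡N)) (cong not ox̄) , x≡1+y)
  where
  x≡1+y : x ≡ suc y
  x≡1+y = mirror-suc x̄+x≡N ȳ+y≡N ȳ≡1+x̄
Step-reverse {N} {x = x} {y} {x̄} {ȳ} rev x̄+x≡N ȳ+y≡N (inj₂ (oȳ , x̄≡1+ȳ)) =
  inj₁ (trans (rev x ȳ (subst (λ z → ȳ + z ≡ N) y≡1+x ȳ+y≡N)) (cong not oȳ) , y≡1+x)
  where
  y≡1+x : y ≡ suc x
  y≡1+x = mirror-suc ȳ+y≡N x̄+x≡N x̄≡1+ȳ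

opposite+toℕ : ∀ {N} (i : Fin (suc N)) → toℕ (opposite i) + toℕ i ≡ N
opposite+toℕ i = trans (cong (_+ toℕ i) (opposite-prop i)) (m∸n+n≡m (s≤s⁻¹ (toℕ<n i)))

Path-reverse : ∀ {N O O′ k} → IsReversal N O O′ →
               HasDominatorColoring (Path (suc N) O) k → HasDominatorColoring (Path (suc N) O′) k
Path-reverse {N} {O} {O′} rev =
  HasDominatorColoring-transport {Path (suc N) O} {Path (suc N) O′}
    opposite opposite opposite-involutive
    (λ u v → Step-reverse {O = O′} (IsReversal-sym rev) (toℕ+opposite u) (toℕ+opposite v))
    (λ u v → Step-reverse {O′ = O′} rev (opposite+toℕ u) (opposite+toℕ v))
  where
  toℕ+opposite : ∀ u → toℕ u + toℕ (opposite u) ≡ N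
  toℕ+opposite u = trans (+-comm (toℕ u) _) (opposite+toℕ u)

Step-into-0 : ∀ {O x} → Step O (suc x) 0 → x ≡ 0
Step-into-0 (inj₁ (_ , ()))
Step-into-0 (inj₂ (_ , 1+x≡1)) = suc-injective 1+x≡1

Step-out-of-0 : ∀ {O x y} → x ≡ 0 → Step O x y → y ≡ 1
Step-out-of-0 refl (inj₁ (_ , y≡1)) = y≡1
Step-out-of-0 refl (inj₂ (_ , ()))

-- If vertex 0 is alone in its color class, deleting it frees that color: give it to vertex 2
-- (vertex 1 of the shorter path).  A vertex that dominated {0} or {2} now dominates {2}.
Path-deleteFirst-unique :
  ∀ {n O k} (c : Fin (suc n) → Fin k) → IsDominatorColoring (Path (suc n) O) k c →
  (∀ w → c (fsuc w) ≢ c fzero) → HasDominatorColoring (Path n (O ∘ suc)) k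
Path-deleteFirst-unique {zero} c _ _ = c ∘ fsuc , IsDominatorColoring-arcless (λ ())
Path-deleteFirst-unique {suc zero} {O} c _ _ =
  c ∘ fsuc , IsDominatorColoring-arcless λ { fzero fzero → Step-irrefl (O ∘ suc) 0 }
Path-deleteFirst-unique {suc (suc m)} {O} {k} c (proper , dominating) unique =
  d , proper′ , dominating′
  where
  Old New : Digraph
  Old = Path (3 + m) O
  New = Path (2 + m) (O ∘ suc)

  one : Fin (2 + m)
  one = fsuc fzero

  d : Fin (2 + m) → Fin k
  d = updateAt (c ∘ fsuc) one (const (c fzero))

  d-one : d one ≡ c fzero
  d-one = updateAt-updates one {const (c fzero)} (c ∘ fsuc)

  d-other : ∀ w → w ≢ one → d w ≡ c (fsuc w)
  d-other w w≢one = updateAt-minimal w one (c ∘ fsuc) w≢one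

  d≡c₀⇒one : ∀ w → d w ≡ c fzero → w ≡ one
  d≡c₀⇒one w dw≡c₀ with w ≟ one
  ... | yes w≡one = w≡one
  ... | no  w≢one = ⊥-elim (unique w (trans (sym (d-other w w≢one)) dw≡c₀))

  proper′ : IsProperColoring New k d
  proper′ = IsProperColoring-update {New} one (c fzero)
    (IsProperColoring-restrict {Old} {New} fsuc (λ _ _ → Step-suc {O}) proper) (λ y _ → unique y)

  dominates-one : ∀ v → Step (O ∘ suc) (toℕ v) 1 → DominatesAClass New k d v
  dominates-one v a = c fzero , (one , d-one) ,
    λ w dw≡c₀ → subst (λ w → Step (O ∘ suc) (toℕ v) (toℕ w)) (sym (d≡c₀⇒one w dw≡c₀)) a

  dominating′ : ∀ v → HasOut New v → DominatesAClass New k d v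
  dominating′ v (u , a) with dominating (fsuc v) (fsuc u , Step-suc {O} a)
  ... | j , (w , cw≡j) , ⊆N⁺ with j ≟ c fzero
  ...   | yes refl = dominates-one v (subst (Step (O ∘ suc) (toℕ v)) u≡1 a)
    where
    u≡1 : toℕ u ≡ 1
    u≡1 = Step-out-of-0 {O ∘ suc} (Step-into-0 {O} (⊆N⁺ fzero refl)) a
  ...   | no j≢c₀ with w
  ...     | fzero = ⊥-elim (j≢c₀ (sym cw≡j))
  ...     | fsuc w′ with w′ ≟ one
  ...       | yes refl = dominates-one v (Step-pred {O} (⊆N⁺ (fsuc one) cw≡j))
  ...       | no w′≢one = j , (w′ , trans (d-other w′ w′≢one) cw≡j) , ⊆N⁺′
    where
    ⊆N⁺′ : ∀ w″ → d w″ ≡ j → Step (O ∘ suc) (toℕ v) (toℕ w″)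
    ⊆N⁺′ w″ dw″≡j = Step-pred {O} (⊆N⁺ (fsuc w″) (trans (sym (d-other w″ w″≢one)) dw″≡j))
      where
      w″≢one : w″ ≢ one
      w″≢one refl = j≢c₀ (trans (sym dw″≡j) d-one)

Path-deleteFirst : ∀ {n O k} →
  HasDominatorColoring (Path (suc n) O) k → HasDominatorColoring (Path n (O ∘ suc)) k
Path-deleteFirst {n} {O} (c , isDC) with any? (λ w → c (fsuc w) ≟ c fzero)
... | yes (w₀ , cw₀≡c₀) =
  c ∘ fsuc , IsDominatorColoring-restrict {Path (suc n) O} {Path n (O ∘ suc)} fsuc
               (λ _ _ → Step-suc {O}) (λ _ _ → Step-pred {O}) isDC meets
  where
  meets : ∀ w → ∃ λ w′ → c (fsuc w′) ≡ c w
  meets fzero    = w₀ , cw₀≡c₀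
  meets (fsuc w) = w , refl
... | no unique = Path-deleteFirst-unique {O = O} c isDC (λ w cw≡c₀ → unique (w , cw≡c₀))

Path-deleteLast : ∀ {n O k} →
  HasDominatorColoring (Path (suc n) O) k → HasDominatorColoring (Path n O) k
Path-deleteLast {zero} _ = (λ ()) , IsDominatorColoring-arcless (λ ())
Path-deleteLast {suc n} {O} =
  Path-reverse {O = R ∘ suc} back ∘ Path-deleteFirst {O = R} ∘ Path-reverse {O = O} there
  where
  R : ℕ → Bool
  R a = not (O (n ∸ a))

  there : IsReversal (suc n) O R
  there a b b+1+a≡1+n = cong (not ∘ O) (trans (cong (_∸ a) (sym b+a≡n)) (m+n∸n≡m b a))
    where
    b+a≡n : b + a ≡ n
    b+a≡n = suc-injective (trans (sym (+-suc b a)) b+1+a≡1+n)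

  back : IsReversal n (R ∘ suc) O
  back a b b+1+a≡n =
    trans (cong O (sym (trans (cong (_∸ suc b) (sym 1+b+a≡n)) (m+n∸m≡n (suc b) a))))
          (sym (not-involutive (O (n ∸ suc b))))
    where
    1+b+a≡n : suc b + a ≡ n
    1+b+a≡n = trans (sym (+-suc b a)) b+1+a≡n

Path-dropHead : ∀ p {j O k} →
  HasDominatorColoring (Path (p + j) O) k → HasDominatorColoring (Path j (λ a → O (p + a))) k
Path-dropHead zero            = λ has → has
Path-dropHead (suc p) {O = O} = Path-dropHead p {O = O ∘ suc} ∘ Path-deleteFirst {O = O}

Path-dropTail : ∀ {j n O k} → j ≤′ n →
  HasDominatorColoring (Path n O) k → HasDominatorColoring (Path j O) k
Path-dropTail (≤′-reflexive refl)      = λ has → has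
Path-dropTail {O = O} (≤′-step j≤′n) = Path-dropTail {O = O} j≤′n ∘ Path-deleteLast {O = O}

Path-subpath : ∀ p {j n O k} → p + j ≤ n →
  HasDominatorColoring (Path n O) k → HasDominatorColoring (Path j (λ a → O (p + a))) k
Path-subpath p {O = O} p+j≤n = Path-dropHead p {O = O} ∘ Path-dropTail {O = O} (≤⇒≤′ p+j≤n)

module UnitSteps {g : ℕ → ℕ} {m : ℕ}
  (adjacent  : ∀ a → suc a < m → g (suc a) ≡ suc (g a) ⊎ g a ≡ suc (g (suc a)))
  (injective : ∀ a b → a < m → b < m → g a ≡ g b → a ≡ b) where

  ascending-persists : ∀ a → suc (suc a) < m →
    g (suc a) ≡ suc (g a) → g (suc (suc a)) ≡ suc (g (suc a))
  ascending-persists a a+2<m up with adjacent (suc a) a+2<m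
  ... | inj₁ up′   = up′
  ... | inj₂ down′ =
    ⊥-elim (2+n≢n (injective _ _ a+2<m (<⇒≤ (<⇒≤ a+2<m)) (suc-injective (trans (sym down′) up))))

  descending-persists : ∀ a → suc (suc a) < m →
    g a ≡ suc (g (suc a)) → g (suc a) ≡ suc (g (suc (suc a)))
  descending-persists a a+2<m down with adjacent (suc a) a+2<m
  ... | inj₁ up′   = ⊥-elim (2+n≢n (injective _ _ a+2<m (<⇒≤ (<⇒≤ a+2<m)) (trans up′ (sym down))))
  ... | inj₂ down′ = down′

  ascending : g 1 ≡ suc (g 0) → ∀ a → suc a < m → g (suc a) ≡ suc (g a)
  ascending up zero    _     = up
  ascending up (suc a) a+2<m = ascending-persists a a+2<m (ascending up a (<⇒≤ a+2<m))

  descending : g 0 ≡ suc (g 1) → ∀ a → suc a < m → g a ≡ suc (g (suc a))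
  descending down zero    _     = down
  descending down (suc a) a+2<m = descending-persists a a+2<m (descending down a (<⇒≤ a+2<m))

  translation : (∀ a → suc a < m → g (suc a) ≡ suc (g a)) → ∀ a → a < m → g a ≡ g 0 + a
  translation up zero    _     = sym (+-identityʳ (g 0))
  translation up (suc a) a+1<m = begin
    g (suc a)     ≡⟨ up a a+1<m ⟩
    suc (g a)     ≡⟨ cong suc (translation up a (<⇒≤ a+1<m)) ⟩
    suc (g 0 + a) ≡⟨ sym (+-suc (g 0) a) ⟩
    g 0 + suc a   ∎

  reflection : (∀ a → suc a < m → g a ≡ suc (g (suc a))) → ∀ a → a < m → g a + a ≡ g 0
  reflection down zero    _     = +-identityʳ (g 0)
  reflection down (suc a) a+1<m = begin
    g (suc a) + suc a     ≡⟨ +-suc (g (suc a)) a ⟩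
    suc (g (suc a)) + a   ≡⟨ cong (_+ a) (sym (down a a+1<m)) ⟩
    g a + a               ≡⟨ reflection down a (<⇒≤ a+1<m) ⟩
    g 0                   ∎

  translation-or-reflection : (∀ a → a < m → g a ≡ g 0 + a) ⊎ (∀ a → a < m → g a + a ≡ g 0)
  translation-or-reflection with 1 <? m
  ... | yes 1<m with adjacent 0 1<m
  ...   | inj₁ up   = inj₁ (translation (ascending up))
  ...   | inj₂ down = inj₂ (reflection (descending down))
  translation-or-reflection | no 1≮m =
    inj₁ (translation λ a a+1<m → ⊥-elim (1≮m (≤-trans (s≤s (s≤s z≤n)) a+1<m)))

module PathEmbedding {m′ n} {om : PathOrientation (suc m′)} {on : PathOrientation n}
  (f : Fin (suc m′) → Fin n) (f-injective : Injective _≡_ _≡_ f)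
  (f-arcs : ∀ u v → Arc (OrientedPath (suc m′) om) u v → Arc (OrientedPath n on) (f u) (f v)) where

  m : ℕ
  m = suc m′

  Om On : ℕ → Bool
  Om = orientationℕ m om
  On = orientationℕ n on

  g : ℕ → ℕ
  g = extend m 0 (toℕ ∘ f)

  g-< : ∀ {a} → a < m → g a < n
  g-< a<m = subst (_< n) (sym (extend-< a<m)) (toℕ<n _)

  g-injective : ∀ a b → a < m → b < m → g a ≡ g b → a ≡ b
  g-injective a b a<m b<m ga≡gb = begin
    a                   ≡⟨ sym (toℕ-fromℕ< a<m) ⟩
    toℕ (fromℕ< a<m)   ≡⟨ cong toℕ (f-injective (toℕ-injective fa≡fb)) ⟩
    toℕ (fromℕ< b<m)   ≡⟨ toℕ-fromℕ< b<m ⟩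
    b                   ∎
    where
    fa≡fb : toℕ (f (fromℕ< a<m)) ≡ toℕ (f (fromℕ< b<m))
    fa≡fb = trans (sym (extend-< a<m)) (trans ga≡gb (extend-< b<m))

  g-step : ∀ {x y} → x < m → y < m → Step Om x y → Step On (g x) (g y)
  g-step x<m y<m s =
    subst₂ (Step On) (sym (extend-< x<m)) (sym (extend-< y<m))
      (OrientedPath-arc⇒Step {n} {on} (f u) (f v)
        (f-arcs u v (Step⇒OrientedPath-arc {m} {om} u v s′)))
    where
    u v : Fin m
    u = fromℕ< x<m
    v = fromℕ< y<m
    s′ : Step Om (toℕ u) (toℕ v)
    s′ = subst₂ (Step Om) (sym (toℕ-fromℕ< x<m)) (sym (toℕ-fromℕ< y<m)) s

  g-adjacent : ∀ a → suc a < m → g (suc a) ≡ suc (g a) ⊎ g a ≡ suc (g (suc a))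
  g-adjacent a a+1<m with Step-edge Om a
  ... | inj₁ s = Step-adjacent {On} (g-step (<⇒≤ a+1<m) a+1<m s)
  ... | inj₂ s = swap (Step-adjacent {On} (g-step a+1<m (<⇒≤ a+1<m) s))

  g-edge : ∀ {a x y} → suc a < m → g a ≡ x → g (suc a) ≡ y →
           (Step Om a (suc a) → Step On x y) × (Step Om (suc a) a → Step On y x)
  g-edge a+1<m ga≡x ga+1≡y =
    (subst₂ (Step On) ga≡x ga+1≡y ∘ g-step (<⇒≤ a+1<m) a+1<m) ,
    (subst₂ (Step On) ga+1≡y ga≡x ∘ g-step a+1<m (<⇒≤ a+1<m))

  translated : ∀ {k} p → (∀ a → a < m → g a ≡ p + a) →
               HasDominatorColoring (OrientedPath n on) k → HasDominatorColoring (OrientedPath m om) k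
  translated p g≡p+ =
    Path⇒OrientedPath {m} {om} ∘ Path-cong {O = On ∘ (p +_)} agree ∘ Path-subpath p {O = On} fits
      ∘ OrientedPath⇒Path {n} {on}
    where
    fits : p + m ≤ n
    fits = subst (_≤ n) (sym (+-suc p m′)) (subst (_< n) (g≡p+ m′ (n<1+n m′)) (g-< (n<1+n m′)))
    agree : ∀ a → suc a < m → On (p + a) ≡ Om a
    agree a a+1<m = sym (orientation-≡ {Om} {On} (g-edge a+1<m (g≡p+ a (<⇒≤ a+1<m)) ga+1≡))
      where
      ga+1≡ : g (suc a) ≡ suc (p + a)
      ga+1≡ = trans (g≡p+ (suc a) a+1<m) (+-suc p a)

  reflected : ∀ {k} P → (∀ a → a < m → g a + a ≡ P) →
              HasDominatorColoring (OrientedPath n on) k → HasDominatorColoring (OrientedPath m om) k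
  reflected P g+id≡P =
    Path⇒OrientedPath {m} {om} ∘ Path-reverse {O = On ∘ (q +_)} agree ∘ Path-subpath q {O = On} fits
      ∘ OrientedPath⇒Path {n} {on}
    where
    q : ℕ
    q = g m′

    q+m′≡P : q + m′ ≡ P
    q+m′≡P = g+id≡P m′ (n<1+n m′)

    fits : q + m ≤ n
    fits = subst (_≤ n) (sym (+-suc q m′)) (subst (_< n) g₀≡q+m′ (g-< (s≤s z≤n)))
      where
      g₀≡q+m′ : g 0 ≡ q + m′
      g₀≡q+m′ = trans (sym (+-identityʳ (g 0))) (trans (g+id≡P 0 (s≤s z≤n)) (sym q+m′≡P))

    agree : IsReversal m′ (On ∘ (q +_)) Om
    agree a b b+1+a≡m′ = orientation-≡-not {Om} {On} (g-edge a+1<m ga≡ ga+1≡)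
      where
      a+1<m : suc a < m
      a+1<m = s≤s (subst (suc a ≤_) b+1+a≡m′ (m≤n+m (suc a) b))

      g+id≡ : ∀ c → c < m → g c + c ≡ q + b + suc a
      g+id≡ c c<m = begin
        g c + c           ≡⟨ g+id≡P c c<m ⟩
        P                 ≡⟨ sym q+m′≡P ⟩
        q + m′            ≡⟨ cong (q +_) (sym b+1+a≡m′) ⟩
        q + (b + suc a)   ≡⟨ sym (+-assoc q b (suc a)) ⟩
        q + b + suc a     ∎

      ga+1≡ : g (suc a) ≡ q + b
      ga+1≡ = +-cancelʳ-≡ (suc a) (g (suc a)) (q + b) (g+id≡ (suc a) a+1<m)

      ga≡ : g a ≡ suc (q + b)
      ga≡ = +-cancelʳ-≡ a (g a) (suc (q + b)) (trans (g+id≡ a (<⇒≤ a+1<m)) (+-suc (q + b) a))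

  HasDominatorColoring-embedded :
    ∀ {k} → HasDominatorColoring (OrientedPath n on) k → HasDominatorColoring (OrientedPath m om) k
  HasDominatorColoring-embedded with UnitSteps.translation-or-reflection g-adjacent g-injective
  ... | inj₁ g≡g₀+ = translated (g 0) g≡g₀+
  ... | inj₂ g+id≡g₀ = reflected (g 0) g+id≡g₀

HasDominatorColoring-subpath :
  ∀ {m n om on k} → IsSubdigraph (OrientedPath m om) (OrientedPath n on) →
  HasDominatorColoring (OrientedPath n on) k → HasDominatorColoring (OrientedPath m om) k
HasDominatorColoring-subpath {zero} _ _ = (λ ()) , IsDominatorColoring-arcless (λ ())
HasDominatorColoring-subpath {suc m′} {om = om} {on} (f , f-injective , f-arcs) =
  PathEmbedding.HasDominatorColoring-embedded {om = om} {on} f f-injective f-arcs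

lemma2 : (m n : ℕ) → 1 ≤ m → m < n →
    (om : PathOrientation m) (on : PathOrientation n) →
    IsSubdigraph (OrientedPath m om) (OrientedPath n on) →
    (a b : ℕ) →
    IsDomChromaticNumber (OrientedPath m om) a →
    IsDomChromaticNumber (OrientedPath n on) b →
    a ≤ b
lemma2 m n _ _ om on Pm⊆Pn a b (_ , a-minimal) (Pn-colorable , _) =
  a-minimal b (HasDominatorColoring-subpath {m} {n} {om} {on} Pm⊆Pn Pn-colorable)
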